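{- A Heyting algebra $A$ has the QE property if and only if the complete theory of $A$ in the language $\{\mathbf 0,\mathbf 1,\vee,\wedge,\to\}$ eliminates quantifiers.
   Context: IPC formulas in $\bar p=(p_1,\dots,p_l)$ are identified with Heyting algebra terms; degree = maximal nesting of $\to$. For $\bar a\in A^l$, $\mathrm{Th}_n(\bar a)=\{\varphi(\bar p):\deg\varphi\le n,\ \varphi(\bar a)=\mathbf 1\}$ and $\bar a\approx_n\bar a'$ iff $\mathrm{Th}_n(\bar a)=\mathrm{Th}_n(\bar a')$. A system of degree $\le d$ in $(\bar p,q)$ is $t(\bar p,q)=\mathbf 1\wedge\bigwedge_{k\le\kappa}s_k(\bar p,q)\ne\mathbf 1$ with $t,s_k$ of degree $\le d$. The $(l,d)$-index $h_{l,d}(A)$ is the least $n$ such that for all $\bar a,\bar a'\in A^l$ with $\bar a\approx_n\bar a'$ and every system $S(\bar p,q)$ of degree $\le d$, $S(\bar a,q)$ has a solution in $A$ iff $S(\bar a',q)$ does; $h_{l,d}(A)=+\infty$ if there is no such $n$. $A$ has the QE property if $h_{l,d}(A)<\infty$ for all integers $l,d$. -}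

module Defs where

open import Level using (Level; _⊔_; Lift)
open import Data.Nat using (ℕ; zero; suc; _≤_) renaming (_⊔_ to _⊔ₙ_)
open import Data.Fin using (Fin)
open import Data.List using (List)
open import Data.List.Relation.Unary.All using (All)
open import Data.Product using (Σ; _×_; ∃)
open import Data.Sum using (_⊎_)
open import Data.Empty renaming (⊥ to Empty)
open import Relation.Nullary using (¬_)
open import Function.Bundles using (_⇔_)
open import Data.Vec.Functional using (Vector; _∷_)
open import Relation.Binary.Lattice.Bundles using (HeytingAlgebra)

-- Terms of the language {0,1,∨,∧,→} in n variables.
-- These are simultaneously the IPC formulas in p₀,…,p_{n-1}
-- (identified with Heyting algebra terms).

data Term (n : ℕ) : Set where
  var      : Fin n → Term n
  𝟘 𝟙      : Term n
  _∨ₜ_ _∧ₜ_ _⇒ₜ_ : Term n → Term n → Term n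

deg : ∀ {n} → Term n → ℕ
deg (var _)  = 0
deg 𝟘        = 0
deg 𝟙        = 0
deg (t ∨ₜ s) = deg t ⊔ₙ deg s
deg (t ∧ₜ s) = deg t ⊔ₙ deg s
deg (t ⇒ₜ s) = suc (deg t ⊔ₙ deg s)

module _ {c ℓ₁ ℓ₂ : Level} (A : HeytingAlgebra c ℓ₁ ℓ₂) where
  open HeytingAlgebra A using (Carrier; _≈_; _∨_; _∧_; _⇨_; ⊤; ⊥)

  ⟦_⟧ : ∀ {n} → Term n → Vector Carrier n → Carrier
  ⟦ var i  ⟧ ρ = ρ i
  ⟦ 𝟘      ⟧ ρ = ⊥
  ⟦ 𝟙      ⟧ ρ = ⊤
  ⟦ t ∨ₜ s ⟧ ρ = ⟦ t ⟧ ρ ∨ ⟦ s ⟧ ρ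
  ⟦ t ∧ₜ s ⟧ ρ = ⟦ t ⟧ ρ ∧ ⟦ s ⟧ ρ
  ⟦ t ⇒ₜ s ⟧ ρ = ⟦ t ⟧ ρ ⇨ ⟦ s ⟧ ρ

  _≈[_]_ : ∀ {l} → Vector Carrier l → ℕ → Vector Carrier l → Set (ℓ₁)
  a ≈[ n ] a' = ∀ (φ : Term _) → deg φ ≤ n → (⟦ φ ⟧ a ≈ ⊤ ⇔ ⟦ φ ⟧ a' ≈ ⊤)

  -- A system  t(p̄,q) = 1 ∧ ⋀ₖ sₖ(p̄,q) ≠ 1  in variables (p̄,q);
  -- the variable q is  zero : Fin (suc l), and pᵢ is  suc i.
  record System (l : ℕ) : Set where
    constructor system
    field
      eqn  : Term (suc l)
      neqs : List (Term (suc l))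

  SysDeg≤ : ∀ {l} → System l → ℕ → Set
  SysDeg≤ (system t ss) d = deg t ≤ d × All (λ s → deg s ≤ d) ss

  Solves : ∀ {l} → System l → Vector Carrier l → Carrier → Set ℓ₁
  Solves (system t ss) a q =
    ⟦ t ⟧ (q ∷ a) ≈ ⊤ × All (λ s → ¬ (⟦ s ⟧ (q ∷ a) ≈ ⊤)) ss

  Solvable : ∀ {l} → System l → Vector Carrier l → Set (c ⊔ ℓ₁)
  Solvable S a = Σ Carrier (Solves S a)

  -- h_{l,d}(A) < ∞ : some n works for all ā, ā' and all systems of degree ≤ d
  IndexFinite : ℕ → ℕ → Set (c ⊔ ℓ₁)
  IndexFinite l d =
    ∃ λ (n : ℕ) → ∀ (a a' : Vector Carrier l) → a ≈[ n ] a' →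
      ∀ (S : System l) → SysDeg≤ S d → (Solvable S a ⇔ Solvable S a')

  QEProperty : Set (c ⊔ ℓ₁)
  QEProperty = ∀ (l d : ℕ) → IndexFinite l d

data Formula (n : ℕ) : Set where
  _≐_  : Term n → Term n → Formula n
  ⊥ᶠ   : Formula n
  ¬ᶠ_  : Formula n → Formula n
  _∧ᶠ_ _∨ᶠ_ _→ᶠ_ : Formula n → Formula n → Formula n
  ∃ᶠ ∀ᶠ : Formula (suc n) → Formula n

data QuantifierFree {n : ℕ} : Formula n → Set where
  qf-≐ : ∀ {t s} → QuantifierFree (t ≐ s)
  qf-⊥ : QuantifierFree ⊥ᶠ
  qf-¬ : ∀ {φ} → QuantifierFree φ → QuantifierFree (¬ᶠ φ)
  qf-∧ : ∀ {φ ψ} → QuantifierFree φ → QuantifierFree ψ → QuantifierFree (φ ∧ᶠ ψ)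
  qf-∨ : ∀ {φ ψ} → QuantifierFree φ → QuantifierFree ψ → QuantifierFree (φ ∨ᶠ ψ)
  qf-→ : ∀ {φ ψ} → QuantifierFree φ → QuantifierFree ψ → QuantifierFree (φ →ᶠ ψ)

module _ {c ℓ₁ ℓ₂ : Level} (A : HeytingAlgebra c ℓ₁ ℓ₂) where
  open HeytingAlgebra A using (Carrier; _≈_)

  _⊨_[_] : ∀ {n} → Formula n → Vector Carrier n → Set (c ⊔ ℓ₁)
  _⊨_[_] (t ≐ s)  ρ = Lift c (⟦ A ⟧ t ρ ≈ ⟦ A ⟧ s ρ)
  _⊨_[_] ⊥ᶠ       ρ = Lift (c ⊔ ℓ₁) Empty
  _⊨_[_] (¬ᶠ φ)   ρ = ¬ (_⊨_[_] φ ρ)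
  _⊨_[_] (φ ∧ᶠ ψ) ρ = _⊨_[_] φ ρ × _⊨_[_] ψ ρ
  _⊨_[_] (φ ∨ᶠ ψ) ρ = _⊨_[_] φ ρ ⊎ _⊨_[_] ψ ρ
  _⊨_[_] (φ →ᶠ ψ) ρ = _⊨_[_] φ ρ → _⊨_[_] ψ ρ
  _⊨_[_] (∃ᶠ φ)   ρ = Σ Carrier λ x → _⊨_[_] φ (x ∷ ρ)
  _⊨_[_] (∀ᶠ φ)   ρ = ∀ (x : Carrier) → _⊨_[_] φ (x ∷ ρ)

  ThEliminatesQuantifiers : Set (c ⊔ ℓ₁)
  ThEliminatesQuantifiers =
    ∀ (n : ℕ) (φ : Formula n) → Σ (Formula n) λ ψ → QuantifierFree ψ ×
      (∀ (ρ : Vector Carrier n) → (_⊨_[_] φ ρ ⇔ _⊨_[_] ψ ρ))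

-- Write ā ≈ₙ ā′ when ā and ā′ satisfy the same formulas of degree ≤ n.  Both conditions are
-- equivalent to a back-and-forth property of these relations: for every N there is an M such
-- that whenever ā ≈_M ā′, every q has a partner q′ with (q, ā) ≈_N (q′, ā′).
--
-- The key input is local finiteness: modulo A there are only finitely many terms of degree ≤ N
-- in a given number of variables, since by induction on N each is a join of meets of variables
-- and implications between representatives of lower degree.  So the ≈_N-class of a tuple is
-- cut out by its type over these representatives u, the list of atoms u = 1 and u ≠ 1, which
-- is at the same time a quantifier-free formula and a system of degree N.  The QE property
-- applied to the type of (q, ā) as a system in q yields back-and-forth, and back-and-forth in
-- turn transfers solutions of any system.  Given back-and-forth, every formula is preserved by
-- some ≈_M (induction on formulas), hence is the disjunction of the finitely many types it
-- meets; conversely, under quantifier elimination "some q realizes this type" is equivalent to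
-- a quantifier-free formula and so is preserved by some ≈_M.

module Submission where

open import Level using (Level; _⊔_; 0ℓ; lift; lower)
open import Function using (_∘_; id; case_of_)
open import Function.Bundles using (_⇔_; mk⇔; module Equivalence)
open Equivalence using (to; from)
import Function.Properties.Equivalence as ⇔
open import Data.Bool using (Bool; true; false)
open import Data.Empty using (⊥-elim)
open import Data.Nat using (ℕ; zero; suc; z≤n; s≤s) renaming (_≤_ to _≤ₙ_; _⊔_ to _⊔ₙ_)
import Data.Nat.Properties as ℕ
open import Data.Fin using (Fin)
open import Data.Product using (_×_; _,_; proj₁; proj₂; ∃-syntax; uncurry; map₂)
open import Data.Product.Function.NonDependent.Propositional using (_×-⇔_)
open import Data.Sum as ⊎ using (inj₁; inj₂; [_,_]′)
open import Data.List
  using (List; []; _∷_; [_]; _++_; map; foldr; filter; allFin; cartesianProductWith)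
open import Data.List.Properties using (∷-injective)
open import Data.List.Membership.Propositional using (_∈_)
open import Data.List.Membership.Propositional.Properties
  using (∈-map⁺; ∈-map⁻; ∈-++⁺ˡ; ∈-++⁺ʳ; ∈-++⁻; ∈-filter⁺; ∈-filter⁻; ∈-allFin;
         ∈-cartesianProductWith⁺; ∈-cartesianProductWith⁻)
open import Data.List.Relation.Binary.Subset.Propositional using (_⊆_)
open import Data.List.Relation.Unary.Any using (here; there)
open import Data.List.Relation.Unary.All as All using (All; []; _∷_)
import Data.List.Relation.Unary.All.Properties as All
open import Data.Vec.Functional using (Vector) renaming (_∷_ to _∷ᵥ_)
open import Relation.Nullary using (¬_; Dec; yes; no; does)
import Relation.Nullary.Decidable as Dec
import Relation.Binary.PropositionalEquality as ≡
open ≡ using (_≡_; refl)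
open import Relation.Binary.Lattice.Bundles using (HeytingAlgebra)
import Relation.Binary.Lattice.Properties.HeytingAlgebra as HeytingAlgebraProperties
import Relation.Binary.Lattice.Properties.MeetSemilattice as MeetSemilatticeProperties
import Relation.Binary.Lattice.Properties.BoundedMeetSemilattice as BoundedMeetSemilatticeProperties
open import Axiom.ExcludedMiddle using (ExcludedMiddle)
open import Defs hiding (⟦_⟧; _≈[_]_)

module _ {a} {X : Set a} where

  sublists : List X → List (List X)
  sublists []       = [ [] ]
  sublists (x ∷ xs) = map (x ∷_) (sublists xs) ++ sublists xs

  filter∈sublists : ∀ {p} {P : X → Set p} (P? : ∀ x → Dec (P x)) xs → filter P? xs ∈ sublists xs
  filter∈sublists P? []       = here refl
  filter∈sublists P? (x ∷ xs) with does (P? x)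
  ... | true  = ∈-++⁺ˡ (∈-map⁺ (x ∷_) (filter∈sublists P? xs))
  ... | false = ∈-++⁺ʳ _ (filter∈sublists P? xs)

  ∈-sublists⇒⊆ : ∀ {ys} xs → ys ∈ sublists xs → ys ⊆ xs
  ∈-sublists⇒⊆ []       (here refl) ()
  ∈-sublists⇒⊆ (x ∷ xs) ys∈ with ∈-++⁻ (map (x ∷_) (sublists xs)) ys∈
  ... | inj₂ ys∈′ = there ∘ ∈-sublists⇒⊆ xs ys∈′
  ... | inj₁ ys∈′ with ∈-map⁻ (x ∷_) ys∈′
  ... | zs , zs∈ , refl = λ where
    (here refl) → here refl
    (there y∈)  → there (∈-sublists⇒⊆ xs zs∈ y∈)

  labellings : List X → List (List Bool)
  labellings []       = [ [] ]
  labellings (_ ∷ xs) = map (true ∷_) (labellings xs) ++ map (false ∷_) (labellings xs)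

  map∈labellings : ∀ (f : X → Bool) xs → map f xs ∈ labellings xs
  map∈labellings f []       = here refl
  map∈labellings f (x ∷ xs) with f x
  ... | true  = ∈-++⁺ˡ (∈-map⁺ (true ∷_) (map∈labellings f xs))
  ... | false = ∈-++⁺ʳ _ (∈-map⁺ (false ∷_) (map∈labellings f xs))

  ∷-≡⇔ : ∀ {x y : X} {xs ys} → (x ≡ y × xs ≡ ys) ⇔ (x ∷ xs ≡ y ∷ ys)
  ∷-≡⇔ = mk⇔ (uncurry (≡.cong₂ _∷_)) ∷-injective

  map-≡⇒≡ : ∀ {b} {Y : Set b} {f g : X → Y} {x xs} → map f xs ≡ map g xs → x ∈ xs → f x ≡ g x
  map-≡⇒≡ eq (here refl) = proj₁ (∷-injective eq)
  map-≡⇒≡ eq (there x∈)  = map-≡⇒≡ (proj₂ (∷-injective eq)) x∈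

module FiniteBounds {c ℓ₁ ℓ₂} (B : HeytingAlgebra c ℓ₁ ℓ₂) where
  open HeytingAlgebra B renaming (refl to ≤-refl)
  open HeytingAlgebraProperties B using (swap-transpose-⇨; ⇨-applyʳ)
  open MeetSemilatticeProperties meetSemilattice using (∧-monotonic; ∧-cong; ∧-assoc)
  open BoundedMeetSemilatticeProperties boundedMeetSemilattice using (identityˡ)
  open import Relation.Binary.Reasoning.Setoid setoid

  ⋀ ⋁ : List Carrier → Carrier
  ⋀ = foldr _∧_ ⊤
  ⋁ = foldr _∨_ ⊥

  ⋀-lowerBound : ∀ {x xs} → x ∈ xs → ⋀ xs ≤ x
  ⋀-lowerBound (here refl) = x∧y≤x _ _
  ⋀-lowerBound (there x∈)  = trans (x∧y≤y _ _) (⋀-lowerBound x∈)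

  ⋀-greatest : ∀ {y xs} → (∀ {x} → x ∈ xs → y ≤ x) → y ≤ ⋀ xs
  ⋀-greatest {xs = []}     _ = maximum _
  ⋀-greatest {xs = x ∷ xs} f = ∧-greatest (f (here refl)) (⋀-greatest (f ∘ there))

  ⋁-upperBound : ∀ {x xs} → x ∈ xs → x ≤ ⋁ xs
  ⋁-upperBound (here refl) = x≤x∨y _ _
  ⋁-upperBound (there x∈)  = trans (⋁-upperBound x∈) (y≤x∨y _ _)

  ⋁-least : ∀ {y xs} → (∀ {x} → x ∈ xs → x ≤ y) → ⋁ xs ≤ y
  ⋁-least {xs = []}     _ = minimum _
  ⋁-least {xs = x ∷ xs} f = ∨-least (f (here refl)) (⋁-least (f ∘ there))

  ⋀-++ : ∀ xs ys → ⋀ (xs ++ ys) ≈ ⋀ xs ∧ ⋀ ys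
  ⋀-++ []       ys = Eq.sym (identityˡ (⋀ ys))
  ⋀-++ (x ∷ xs) ys = begin
    x ∧ ⋀ (xs ++ ys)    ≈⟨ ∧-cong Eq.refl (⋀-++ xs ys) ⟩
    x ∧ (⋀ xs ∧ ⋀ ys)   ≈⟨ ∧-assoc x (⋀ xs) (⋀ ys) ⟨
    (x ∧ ⋀ xs) ∧ ⋀ ys   ∎

  ⋁∧⋁-least : ∀ {xs ys z} → (∀ {x y} → x ∈ xs → y ∈ ys → x ∧ y ≤ z) → ⋁ xs ∧ ⋁ ys ≤ z
  ⋁∧⋁-least {xs} {ys} {z} f = transpose-∧ (⋁-least (transpose-⇨ ∘ x∧⋁ys≤z))
    where
    x∧⋁ys≤z : ∀ {x} → x ∈ xs → x ∧ ⋁ ys ≤ z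
    x∧⋁ys≤z x∈ = trans (∧-monotonic ≤-refl (⋁-least (swap-transpose-⇨ ∘ f x∈))) (⇨-applyʳ ≤-refl)

-- On the bounded sublattice generated by G, dnf is the identity up to ≈ (by distributivity),
-- and it only ever takes the finitely many values listed in normalForms.
module NormalForm {c ℓ₁ ℓ₂} (B : HeytingAlgebra c ℓ₁ ℓ₂)
                  (_≤?_ : ∀ x y → Dec (HeytingAlgebra._≤_ B x y))
                  (G : List (HeytingAlgebra.Carrier B)) where
  open HeytingAlgebra B renaming (refl to ≤-refl)
  open MeetSemilatticeProperties meetSemilattice using (∧-monotonic)
  open FiniteBounds B

  meetsBelow : Carrier → List (List Carrier)
  meetsBelow x = filter (λ S → ⋀ S ≤? x) (sublists G)

  dnf : Carrier → Carrier
  dnf x = ⋁ (map ⋀ (meetsBelow x))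

  normalForms : List Carrier
  normalForms = map (⋁ ∘ map ⋀) (sublists (sublists G))

  dnf∈normalForms : ∀ x → dnf x ∈ normalForms
  dnf∈normalForms x = ∈-map⁺ (⋁ ∘ map ⋀) (filter∈sublists (λ S → ⋀ S ≤? x) (sublists G))

  ∈-meetsBelow⁻ : ∀ {x m} → m ∈ map ⋀ (meetsBelow x) → ∃[ S ] S ⊆ G × ⋀ S ≤ x × m ≡ ⋀ S
  ∈-meetsBelow⁻ {x} m∈ with ∈-map⁻ ⋀ m∈
  ... | S , S∈ , m≡ = let S∈′ , ⋀S≤x = ∈-filter⁻ (λ S → ⋀ S ≤? x) S∈ in
                      S , ∈-sublists⇒⊆ G S∈′ , ⋀S≤x , m≡

  dnf-least : ∀ {x z} → (∀ {S} → S ⊆ G → ⋀ S ≤ x → ⋀ S ≤ z) → dnf x ≤ z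
  dnf-least f = ⋁-least λ m∈ → case ∈-meetsBelow⁻ m∈ of λ where
    (S , S⊆G , ⋀S≤x , refl) → f S⊆G ⋀S≤x

  dnf≤ : ∀ x → dnf x ≤ x
  dnf≤ x = dnf-least λ _ ⋀S≤x → ⋀S≤x

  -- Replacing S by the set of all generators above y keeps the meet inside meetsBelow x.
  ≤dnf-via : ∀ {S x y} → S ⊆ G → y ≤ ⋀ S → ⋀ S ≤ x → y ≤ dnf x
  ≤dnf-via {S} {x} {y} S⊆G y≤⋀S ⋀S≤x = trans y≤⋀C (⋁-upperBound (∈-map⁺ ⋀ C∈meetsBelow))
    where
    C = filter (y ≤?_) G
    y≤⋀C : y ≤ ⋀ C
    y≤⋀C = ⋀-greatest (proj₂ ∘ ∈-filter⁻ (y ≤?_) {xs = G})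
    ⋀C≤⋀S : ⋀ C ≤ ⋀ S
    ⋀C≤⋀S = ⋀-greatest λ g∈S →
      ⋀-lowerBound (∈-filter⁺ (y ≤?_) (S⊆G g∈S) (trans y≤⋀S (⋀-lowerBound g∈S)))
    C∈meetsBelow : C ∈ meetsBelow x
    C∈meetsBelow = ∈-filter⁺ (λ S → ⋀ S ≤? x) (filter∈sublists (y ≤?_) G) (trans ⋀C≤⋀S ⋀S≤x)

  dnf-mono : ∀ {x x′} → x ≤ x′ → dnf x ≤ dnf x′
  dnf-mono x≤x′ = dnf-least λ S⊆G ⋀S≤x → ≤dnf-via S⊆G ≤-refl (trans ⋀S≤x x≤x′)

  ≈generator⇒≤dnf : ∀ {x} → ∃[ g ] g ∈ G × x ≈ g → x ≤ dnf x
  ≈generator⇒≤dnf {x} (g , g∈G , x≈g) =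
    ≤dnf-via {S = [ g ]} (λ { (here refl) → g∈G })
      (∧-greatest (reflexive x≈g) (maximum x)) (trans (x∧y≤x g ⊤) (reflexive (Eq.sym x≈g)))

  ⊤≤dnf : ⊤ ≤ dnf ⊤
  ⊤≤dnf = ≤dnf-via {S = []} (λ ()) ≤-refl ≤-refl

  ∨-≤dnf : ∀ {x y} → x ≤ dnf x → y ≤ dnf y → x ∨ y ≤ dnf (x ∨ y)
  ∨-≤dnf {x} {y} x≤ y≤ = ∨-least (trans x≤ (dnf-mono (x≤x∨y x y))) (trans y≤ (dnf-mono (y≤x∨y x y)))

  ∧-≤dnf : ∀ {x y} → x ≤ dnf x → y ≤ dnf y → x ∧ y ≤ dnf (x ∧ y)
  ∧-≤dnf x≤ y≤ = trans (∧-monotonic x≤ y≤) (⋁∧⋁-least λ m∈ n∈ →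
    case ∈-meetsBelow⁻ m∈ , ∈-meetsBelow⁻ n∈ of λ where
      ((S , S⊆G , ⋀S≤x , refl) , (T , T⊆G , ⋀T≤y , refl)) →
        ≤dnf-via (λ g∈ → [ S⊆G , T⊆G ]′ (∈-++⁻ S g∈))
          (reflexive (Eq.sym (⋀-++ S T))) (trans (reflexive (⋀-++ S T)) (∧-monotonic ⋀S≤x ⋀T≤y)))

_⇔ₜ_ : ∀ {m} → Term m → Term m → Term m
t ⇔ₜ s = (t ⇒ₜ s) ∧ₜ (s ⇒ₜ t)

⋀ₜ ⋁ₜ : ∀ {m} → List (Term m) → Term m
⋀ₜ = foldr _∧ₜ_ 𝟙
⋁ₜ = foldr _∨ₜ_ 𝟘

deg-⋀ₜ : ∀ {m d} {ts : List (Term m)} → All (λ t → deg t ≤ₙ d) ts → deg (⋀ₜ ts) ≤ₙ d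
deg-⋀ₜ []       = z≤n
deg-⋀ₜ (p ∷ ps) = ℕ.⊔-lub p (deg-⋀ₜ ps)

deg-⋁ₜ : ∀ {m d} {ts : List (Term m)} → All (λ t → deg t ≤ₙ d) ts → deg (⋁ₜ ts) ≤ₙ d
deg-⋁ₜ []       = z≤n
deg-⋁ₜ (p ∷ ps) = ℕ.⊔-lub p (deg-⋁ₜ ps)

variables : ∀ m → List (Term m)
variables m = map var (allFin m)

∈-variables : ∀ {m} (i : Fin m) → var i ∈ variables m
∈-variables i = ∈-map⁺ var (∈-allFin i)

variables-deg : ∀ {m d} → All (λ t → deg t ≤ₙ d) (variables m)
variables-deg = All.map⁺ (All.tabulate λ _ → z≤n)

implications : ∀ {m} → List (Term m) → List (Term m)
implications ts = cartesianProductWith _⇒ₜ_ ts ts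

implications-deg : ∀ {m d} {ts : List (Term m)} →
  All (λ t → deg t ≤ₙ d) ts → All (λ t → deg t ≤ₙ suc d) (implications ts)
implications-deg {ts = ts} ts-deg = All.tabulate λ u∈ →
  case ∈-cartesianProductWith⁻ _⇒ₜ_ ts ts u∈ of λ where
    (a , b , a∈ , b∈ , refl) → s≤s (ℕ.⊔-lub (All.lookup ts-deg a∈) (All.lookup ts-deg b∈))

⋁ᶠ : ∀ {n} → List (Formula n) → Formula n
⋁ᶠ = foldr _∨ᶠ_ ⊥ᶠ

⋁ᶠ-qf : ∀ {n} {φs : List (Formula n)} → All QuantifierFree φs → QuantifierFree (⋁ᶠ φs)
⋁ᶠ-qf []         = qf-⊥
⋁ᶠ-qf (qf ∷ qfs) = qf-∨ qf (⋁ᶠ-qf qfs)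

⋁ᶠ-intro : ∀ {c ℓ₁ ℓ₂} {A : HeytingAlgebra c ℓ₁ ℓ₂} {n} {φ : Formula n} {φs ρ} →
  φ ∈ φs → A ⊨ φ [ ρ ] → A ⊨ ⋁ᶠ φs [ ρ ]
⋁ᶠ-intro (here refl) ρ⊨φ = inj₁ ρ⊨φ
⋁ᶠ-intro (there φ∈)  ρ⊨φ = inj₂ (⋁ᶠ-intro φ∈ ρ⊨φ)

⋁ᶠ-elim : ∀ {c ℓ₁ ℓ₂} {A : HeytingAlgebra c ℓ₁ ℓ₂} {n} {φs : List (Formula n)} {ρ} →
  A ⊨ ⋁ᶠ φs [ ρ ] → ∃[ φ ] φ ∈ φs × A ⊨ φ [ ρ ]
⋁ᶠ-elim {φs = φ ∷ φs} (inj₁ ρ⊨φ) = φ , here refl , ρ⊨φ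
⋁ᶠ-elim {φs = φ ∷ φs} (inj₂ ρ⊨⋁) = let ψ , ψ∈ , ρ⊨ψ = ⋁ᶠ-elim ρ⊨⋁ in ψ , there ψ∈ , ρ⊨ψ

literal : ∀ {n} → Term n → Bool → Formula n
literal u true  = u ≐ 𝟙
literal u false = ¬ᶠ (u ≐ 𝟙)

typeFormula : ∀ {n} → List (Term n) → List Bool → Formula n
typeFormula []      []      = ¬ᶠ ⊥ᶠ
typeFormula []      (_ ∷ _) = ⊥ᶠ
typeFormula (_ ∷ _) []      = ⊥ᶠ
typeFormula (u ∷ L) (b ∷ P) = literal u b ∧ᶠ typeFormula L P

typeFormula-qf : ∀ {n} (L : List (Term n)) P → QuantifierFree (typeFormula L P)
typeFormula-qf []      []          = qf-¬ qf-⊥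
typeFormula-qf []      (_ ∷ _)     = qf-⊥
typeFormula-qf (_ ∷ _) []          = qf-⊥
typeFormula-qf (u ∷ L) (true ∷ P)  = qf-∧ qf-≐ (typeFormula-qf L P)
typeFormula-qf (u ∷ L) (false ∷ P) = qf-∧ (qf-¬ qf-≐) (typeFormula-qf L P)

module _ {c ℓ₁ ℓ₂} (A : HeytingAlgebra c ℓ₁ ℓ₂) where
  open HeytingAlgebra A renaming (refl to ≤-refl; trans to ≤-trans)

  ⟦_⟧ : ∀ {n} → Term n → Vector Carrier n → Carrier
  ⟦_⟧ = Defs.⟦_⟧ A

  _≈[_]_ : ∀ {l} → Vector Carrier l → ℕ → Vector Carrier l → Set ℓ₁
  _≈[_]_ = Defs._≈[_]_ A

  ⊤≤⇒≈⊤ : ∀ {x} → ⊤ ≤ x → x ≈ ⊤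
  ⊤≤⇒≈⊤ = antisym (maximum _)

  ≈⊤-resp : ∀ {x y} → x ≈ y → (x ≈ ⊤ ⇔ y ≈ ⊤)
  ≈⊤-resp x≈y = mk⇔ (Eq.trans (Eq.sym x≈y)) (Eq.trans x≈y)

  ∧≈⊤⇔ : ∀ {x y} → x ∧ y ≈ ⊤ ⇔ (x ≈ ⊤ × y ≈ ⊤)
  ∧≈⊤⇔ = mk⇔
    (λ x∧y≈⊤ → ⊤≤⇒≈⊤ (≤-trans (reflexive (Eq.sym x∧y≈⊤)) (x∧y≤x _ _)) ,
               ⊤≤⇒≈⊤ (≤-trans (reflexive (Eq.sym x∧y≈⊤)) (x∧y≤y _ _)))
    (λ (x≈⊤ , y≈⊤) → ⊤≤⇒≈⊤ (∧-greatest (reflexive (Eq.sym x≈⊤)) (reflexive (Eq.sym y≈⊤))))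

  ⇨≈⊤⇔≤ : ∀ {x y} → x ⇨ y ≈ ⊤ ⇔ x ≤ y
  ⇨≈⊤⇔≤ = mk⇔
    (λ x⇨y≈⊤ → ≤-trans (∧-greatest (≤-trans (maximum _) (reflexive (Eq.sym x⇨y≈⊤))) ≤-refl)
                        (transpose-∧ ≤-refl))
    (λ x≤y → ⊤≤⇒≈⊤ (transpose-⇨ (≤-trans (x∧y≤y _ _) x≤y)))

  ≈⇔⇨∧⇨≈⊤ : ∀ {x y} → x ≈ y ⇔ (x ⇨ y) ∧ (y ⇨ x) ≈ ⊤
  ≈⇔⇨∧⇨≈⊤ = ⇔.trans
    (mk⇔ (λ x≈y → reflexive x≈y , reflexive (Eq.sym x≈y)) (uncurry antisym))
    (⇔.sym (⇔.trans ∧≈⊤⇔ (⇨≈⊤⇔≤ ×-⇔ ⇨≈⊤⇔≤)))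

  infix 4 _≃_ _≼_ _∈≃_

  _≃_ : ∀ {m} → Term m → Term m → Set (c ⊔ ℓ₁)
  t ≃ u = ∀ ρ → ⟦ t ⟧ ρ ≈ ⟦ u ⟧ ρ

  _≼_ : ∀ {m} → Term m → Term m → Set (c ⊔ ℓ₂)
  t ≼ u = ∀ ρ → ⟦ t ⟧ ρ ≤ ⟦ u ⟧ ρ

  _∈≃_ : ∀ {m} → Term m → List (Term m) → Set (c ⊔ ℓ₁)
  t ∈≃ L = ∃[ u ] u ∈ L × t ≃ u

  termAlgebra : ℕ → HeytingAlgebra 0ℓ (c ⊔ ℓ₁) (c ⊔ ℓ₂)
  termAlgebra m = record
    { Carrier = Term m ; _≈_ = _≃_ ; _≤_ = _≼_
    ; _∨_ = _∨ₜ_ ; _∧_ = _∧ₜ_ ; _⇨_ = _⇒ₜ_ ; ⊤ = 𝟙 ; ⊥ = 𝟘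
    ; isHeytingAlgebra = record
      { isBoundedLattice = record
        { isLattice = record
          { isPartialOrder = record
            { isPreorder = record
              { isEquivalence = record
                { refl  = λ _ → Eq.refl
                ; sym   = λ t≃u ρ → Eq.sym (t≃u ρ)
                ; trans = λ t≃u u≃v ρ → Eq.trans (t≃u ρ) (u≃v ρ)
                }
              ; reflexive = λ t≃u ρ → reflexive (t≃u ρ)
              ; trans     = λ t≼u u≼v ρ → ≤-trans (t≼u ρ) (u≼v ρ)
              }
            ; antisym = λ t≼u u≼t ρ → antisym (t≼u ρ) (u≼t ρ)
            }
          ; supremum = λ _ _ →
              (λ _ → x≤x∨y _ _) , (λ _ → y≤x∨y _ _) , λ _ t≼v u≼v ρ → ∨-least (t≼v ρ) (u≼v ρ)
          ; infimum = λ _ _ →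
              (λ _ → x∧y≤x _ _) , (λ _ → x∧y≤y _ _) , λ _ v≼t v≼u ρ → ∧-greatest (v≼t ρ) (v≼u ρ)
          }
        ; maximum = λ _ _ → maximum _
        ; minimum = λ _ _ → minimum _
        }
      ; exponential = λ _ _ _ → (λ p ρ → transpose-⇨ (p ρ)) , (λ p ρ → transpose-∧ (p ρ))
      }
    }

  record Cover (m d : ℕ) : Set (c ⊔ ℓ₁) where
    field
      members     : List (Term m)
      members-deg : All (λ u → deg u ≤ₙ d) members
      complete    : ∀ t → deg t ≤ₙ d → t ∈≃ members

  ≈[]-sym : ∀ {l N} {a a′ : Vector Carrier l} → a ≈[ N ] a′ → a′ ≈[ N ] a
  ≈[]-sym a≈a′ φ dφ = ⇔.sym (a≈a′ φ dφ)

  ≈[]-antimono : ∀ {l N M} {a a′ : Vector Carrier l} → N ≤ₙ M → a ≈[ M ] a′ → a ≈[ N ] a′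
  ≈[]-antimono N≤M a≈a′ φ dφ = a≈a′ φ (ℕ.≤-trans dφ N≤M)

  Invariant : ∀ {n} → ℕ → Formula n → Set (c ⊔ ℓ₁)
  Invariant N φ = ∀ {ρ ρ′} → ρ ≈[ N ] ρ′ → A ⊨ φ [ ρ ] → A ⊨ φ [ ρ′ ]

  Invariant-mono : ∀ {n N M} {φ : Formula n} → N ≤ₙ M → Invariant N φ → Invariant M φ
  Invariant-mono N≤M inv = inv ∘ ≈[]-antimono N≤M

  invariant₂ : ∀ {n} {φ ψ : Formula n} (_∙_ : Formula n → Formula n → Formula n) →
    (∀ {N} → Invariant N φ → Invariant N ψ → Invariant N (φ ∙ ψ)) →
    ∃[ N ] Invariant N φ → ∃[ N ] Invariant N ψ → ∃[ N ] Invariant N (φ ∙ ψ)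
  invariant₂ _ combine (N , inv) (M , inv′) =
    N ⊔ₙ M , combine (Invariant-mono (ℕ.m≤m⊔n N M) inv) (Invariant-mono (ℕ.m≤n⊔m N M) inv′)

  ≐-invariant : ∀ {n} (t s : Term n) → Invariant (deg (t ⇔ₜ s)) (t ≐ s)
  ≐-invariant t s ρ≈ρ′ (lift t≈s) =
    lift (from ≈⇔⇨∧⇨≈⊤ (to (ρ≈ρ′ (t ⇔ₜ s) ℕ.≤-refl) (to ≈⇔⇨∧⇨≈⊤ t≈s)))

  ¬-invariant : ∀ {n N} {φ : Formula n} → Invariant N φ → Invariant N (¬ᶠ φ)
  ¬-invariant inv ρ≈ρ′ ¬φ φ′ = ¬φ (inv (≈[]-sym ρ≈ρ′) φ′)

  ∧-invariant : ∀ {n N} {φ ψ : Formula n} → Invariant N φ → Invariant N ψ → Invariant N (φ ∧ᶠ ψ)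
  ∧-invariant inv inv′ ρ≈ρ′ (φ , ψ) = inv ρ≈ρ′ φ , inv′ ρ≈ρ′ ψ

  ∨-invariant : ∀ {n N} {φ ψ : Formula n} → Invariant N φ → Invariant N ψ → Invariant N (φ ∨ᶠ ψ)
  ∨-invariant inv inv′ ρ≈ρ′ = ⊎.map (inv ρ≈ρ′) (inv′ ρ≈ρ′)

  →-invariant : ∀ {n N} {φ ψ : Formula n} → Invariant N φ → Invariant N ψ → Invariant N (φ →ᶠ ψ)
  →-invariant inv inv′ ρ≈ρ′ φ→ψ = inv′ ρ≈ρ′ ∘ φ→ψ ∘ inv (≈[]-sym ρ≈ρ′)

  qf-invariant : ∀ {n} {φ : Formula n} → QuantifierFree φ → ∃[ N ] Invariant N φ
  qf-invariant (qf-≐ {t} {s}) = _ , ≐-invariant t s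
  qf-invariant qf-⊥           = 0 , λ _ → id
  qf-invariant (qf-¬ qf)      = map₂ ¬-invariant (qf-invariant qf)
  qf-invariant (qf-∧ qf qf′)  = invariant₂ _∧ᶠ_ ∧-invariant (qf-invariant qf) (qf-invariant qf′)
  qf-invariant (qf-∨ qf qf′)  = invariant₂ _∨ᶠ_ ∨-invariant (qf-invariant qf) (qf-invariant qf′)
  qf-invariant (qf-→ qf qf′)  = invariant₂ _→ᶠ_ →-invariant (qf-invariant qf) (qf-invariant qf′)

  Definable : ∀ {n} → Formula n → Set (c ⊔ ℓ₁)
  Definable φ = ∃[ ψ ] QuantifierFree ψ × (∀ ρ → A ⊨ φ [ ρ ] ⇔ A ⊨ ψ [ ρ ])

  definable⇒invariant : ∀ {n} {φ : Formula n} → Definable φ → ∃[ N ] Invariant N φ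
  definable⇒invariant (ψ , qf , φ⇔ψ) =
    let N , inv = qf-invariant qf in
    N , λ ρ≈ρ′ → from (φ⇔ψ _) ∘ inv ρ≈ρ′ ∘ to (φ⇔ψ _)

  uniformDegree : ∀ {n} {X : Set} (Φ : X → Formula n) → (∀ x → ∃[ N ] Invariant N (Φ x)) →
    ∀ xs → ∃[ N ] (∀ {x} → x ∈ xs → Invariant N (Φ x))
  uniformDegree Φ inv []       = 0 , λ ()
  uniformDegree Φ inv (x ∷ xs) with inv x | uniformDegree Φ inv xs
  ... | N , inv-x | M , inv-xs = N ⊔ₙ M , λ where
    (here refl) → Invariant-mono (ℕ.m≤m⊔n N M) inv-x
    (there x∈)  → Invariant-mono (ℕ.m≤n⊔m N M) (inv-xs x∈)

  ExtensionProperty : Set (c ⊔ ℓ₁)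
  ExtensionProperty = ∀ l N → ∃[ M ] ∀ {a a′ : Vector Carrier l} → a ≈[ M ] a′ →
    ∀ q → ∃[ q′ ] (q ∷ᵥ a) ≈[ N ] (q′ ∷ᵥ a′)

  ∃-invariant : ExtensionProperty → ∀ {n N} {φ : Formula (suc n)} →
    Invariant N φ → ∃[ M ] Invariant M (∃ᶠ φ)
  ∃-invariant ext {n} {N} inv with ext n N
  ... | M , extend = M , λ a≈a′ (q , φ) →
    let q′ , qa≈q′a′ = extend a≈a′ q in q′ , inv qa≈q′a′ φ

  ∀-invariant : ExtensionProperty → ∀ {n N} {φ : Formula (suc n)} →
    Invariant N φ → ∃[ M ] Invariant M (∀ᶠ φ)
  ∀-invariant ext {n} {N} inv with ext n N
  ... | M , extend = M , λ a≈a′ ∀φ q′ →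
    let q , q′a′≈qa = extend (≈[]-sym a≈a′) q′ in inv (≈[]-sym q′a′≈qa) (∀φ q)

  extension⇒invariant : ExtensionProperty → ∀ {n} (φ : Formula n) → ∃[ N ] Invariant N φ
  extension⇒invariant ext = invariant
    where
    invariant : ∀ {n} (φ : Formula n) → ∃[ N ] Invariant N φ
    invariant (t ≐ s)  = _ , ≐-invariant t s
    invariant ⊥ᶠ       = 0 , λ _ → id
    invariant (¬ᶠ φ)   = map₂ ¬-invariant (invariant φ)
    invariant (φ ∧ᶠ ψ) = invariant₂ _∧ᶠ_ ∧-invariant (invariant φ) (invariant ψ)
    invariant (φ ∨ᶠ ψ) = invariant₂ _∨ᶠ_ ∨-invariant (invariant φ) (invariant ψ)
    invariant (φ →ᶠ ψ) = invariant₂ _→ᶠ_ →-invariant (invariant φ) (invariant ψ)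
    invariant (∃ᶠ φ)   = ∃-invariant ext (proj₂ (invariant φ))
    invariant (∀ᶠ φ)   = ∀-invariant ext (proj₂ (invariant φ))

  solves-transfer : ∀ {l d} (S : System A l) → SysDeg≤ A S d → ∀ {a a′ q q′} →
    (q ∷ᵥ a) ≈[ d ] (q′ ∷ᵥ a′) → Solves A S a q → Solves A S a′ q′
  solves-transfer (system t ss) (t-deg , ss-deg) qa≈q′a′ (t≈⊤ , ss≉⊤) =
    to (qa≈q′a′ t t-deg) t≈⊤ ,
    All.zipWith (λ {s} (s-deg , s≉⊤) → s≉⊤ ∘ from (qa≈q′a′ s s-deg)) (ss-deg , ss≉⊤)

  extension⇒qeProperty : ExtensionProperty → QEProperty A
  extension⇒qeProperty ext l d = M , λ a a′ a≈a′ S S-deg →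
    mk⇔ (transfer S S-deg a≈a′) (transfer S S-deg (≈[]-sym a≈a′))
    where
    M = proj₁ (ext l d)
    transfer : ∀ S → SysDeg≤ A S d → ∀ {a a′} → a ≈[ M ] a′ → Solvable A S a → Solvable A S a′
    transfer S S-deg a≈a′ (q , q-solves) =
      let q′ , qa≈q′a′ = proj₂ (ext l d) a≈a′ q in q′ , solves-transfer S S-deg qa≈q′a′ q-solves

  addLiteral : ∀ {l} → Term (suc l) → Bool → System A l → System A l
  addLiteral u true  (system t ss) = system (u ∧ₜ t) ss
  addLiteral u false (system t ss) = system t (u ∷ ss)

  -- The system counterpart of typeFormula; unsolvable on a length mismatch.
  typeSystem : ∀ {l} → List (Term (suc l)) → List Bool → System A l
  typeSystem []      []      = system 𝟙 []
  typeSystem []      (_ ∷ _) = system 𝟙 (𝟙 ∷ [])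
  typeSystem (_ ∷ _) []      = system 𝟙 (𝟙 ∷ [])
  typeSystem (u ∷ L) (b ∷ P) = addLiteral u b (typeSystem L P)

  addLiteral-deg : ∀ {l N} {u : Term (suc l)} b (S : System A l) →
    deg u ≤ₙ N → SysDeg≤ A S N → SysDeg≤ A (addLiteral u b S) N
  addLiteral-deg true  (system t ss) u-deg (t-deg , ss-deg) = ℕ.⊔-lub u-deg t-deg , ss-deg
  addLiteral-deg false (system t ss) u-deg (t-deg , ss-deg) = t-deg , u-deg ∷ ss-deg

  typeSystem-deg : ∀ {l N} (L : List (Term (suc l))) P → All (λ u → deg u ≤ₙ N) L →
    SysDeg≤ A (typeSystem L P) N
  typeSystem-deg []      []      _               = z≤n , []
  typeSystem-deg []      (_ ∷ _) _               = z≤n , z≤n ∷ []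
  typeSystem-deg (_ ∷ _) []      _               = z≤n , z≤n ∷ []
  typeSystem-deg (u ∷ L) (b ∷ P) (u-deg ∷ L-deg) =
    addLiteral-deg b (typeSystem L P) u-deg (typeSystem-deg L P L-deg)

  unsolvable : ∀ {l} {a : Vector Carrier l} {q} → ¬ Solves A (system 𝟙 (𝟙 ∷ [])) a q
  unsolvable (_ , 𝟙≉⊤ ∷ _) = 𝟙≉⊤ Eq.refl

  module _ (em : ExcludedMiddle (c ⊔ ℓ₁)) where

    normalFormCover : ∀ {m d} (G : List (Term m)) → All (λ g → deg g ≤ₙ d) G →
      (∀ i → var i ∈≃ G) → (∀ a b → deg (a ⇒ₜ b) ≤ₙ d → (a ⇒ₜ b) ∈≃ G) → Cover m d
    normalFormCover {m} {d} G G-deg var∈≃G ⇒∈≃G = record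
      { members     = normalForms
      ; members-deg = All.map⁺ (All.tabulate λ X∈ → deg-⋁ₜ (All.map⁺ (All.tabulate λ S∈ →
          deg-⋀ₜ (All.anti-mono (∈-sublists⇒⊆ G (∈-sublists⇒⊆ (sublists G) X∈ S∈)) G-deg))))
      ; complete    = λ t t-deg →
          dnf t , dnf∈normalForms t , T.antisym {t} {dnf t} (≤dnf t t-deg) (dnf≤ t)
      }
      where
      module T = HeytingAlgebra (termAlgebra m)
      open MeetSemilatticeProperties T.meetSemilattice using (≈-dec⇒≤-dec)
      open NormalForm (termAlgebra m) (≈-dec⇒≤-dec (λ _ _ → em)) G

      ≤dnf : ∀ t → deg t ≤ₙ d → t ≼ dnf t
      ≤dnf (var i)  _      = ≈generator⇒≤dnf (var∈≃G i)
      ≤dnf 𝟘        _      = T.minimum (dnf 𝟘)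
      ≤dnf 𝟙        _      = ⊤≤dnf
      ≤dnf (a ∨ₜ b) ab-deg = ∨-≤dnf (≤dnf a (ℕ.m⊔n≤o⇒m≤o _ _ ab-deg)) (≤dnf b (ℕ.m⊔n≤o⇒n≤o _ _ ab-deg))
      ≤dnf (a ∧ₜ b) ab-deg = ∧-≤dnf (≤dnf a (ℕ.m⊔n≤o⇒m≤o _ _ ab-deg)) (≤dnf b (ℕ.m⊔n≤o⇒n≤o _ _ ab-deg))
      ≤dnf (a ⇒ₜ b) ab-deg = ≈generator⇒≤dnf (⇒∈≃G a b ab-deg)

    cover : ∀ m d → Cover m d
    cover m zero    = normalFormCover (variables m) variables-deg
      (λ i → var i , ∈-variables i , λ _ → Eq.refl) (λ _ _ ())
    cover m (suc d) = normalFormCover (variables m ++ implications members)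
      (All.++⁺ variables-deg (implications-deg members-deg))
      (λ i → var i , ∈-++⁺ˡ (∈-variables i) , λ _ → Eq.refl) ⇒∈≃G
      where
      open Cover (cover m d)
      open HeytingAlgebraProperties (termAlgebra m) using (⇨-cong)
      ⇒∈≃G : ∀ a b → deg (a ⇒ₜ b) ≤ₙ suc d → (a ⇒ₜ b) ∈≃ (variables m ++ implications members)
      ⇒∈≃G a b (s≤s ab-deg)
        with complete a (ℕ.m⊔n≤o⇒m≤o _ _ ab-deg) | complete b (ℕ.m⊔n≤o⇒n≤o _ _ ab-deg)
      ... | u , u∈ , a≃u | v , v∈ , b≃v =
        u ⇒ₜ v , ∈-++⁺ʳ (variables m) (∈-cartesianProductWith⁺ _⇒ₜ_ u∈ v∈) ,
        ⇨-cong {a} {u} {b} {v} a≃u b≃v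

    holds? : ∀ {n} (ρ : Vector Carrier n) (u : Term n) → Dec (⟦ u ⟧ ρ ≈ ⊤)
    holds? ρ u = Dec.map′ lower (lift {ℓ = c}) em

    truth : ∀ {n} → Vector Carrier n → Term n → Bool
    truth ρ u with holds? ρ u
    ... | yes _ = true
    ... | no  _ = false

    typeOf : ∀ {n} → List (Term n) → Vector Carrier n → List Bool
    typeOf L ρ = map (truth ρ) L

    truth≡true⇔ : ∀ {n} {ρ : Vector Carrier n} {u} → truth ρ u ≡ true ⇔ ⟦ u ⟧ ρ ≈ ⊤
    truth≡true⇔ {ρ = ρ} {u} with holds? ρ u
    ... | yes u≈⊤ = mk⇔ (λ _ → u≈⊤) (λ _ → refl)
    ... | no  u≉⊤ = mk⇔ (λ ()) (⊥-elim ∘ u≉⊤)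

    truth≡false⇔ : ∀ {n} {ρ : Vector Carrier n} {u} → truth ρ u ≡ false ⇔ (¬ ⟦ u ⟧ ρ ≈ ⊤)
    truth≡false⇔ {ρ = ρ} {u} with holds? ρ u
    ... | yes u≈⊤ = mk⇔ (λ ()) (λ u≉⊤ → ⊥-elim (u≉⊤ u≈⊤))
    ... | no  u≉⊤ = mk⇔ (λ _ → u≉⊤) (λ _ → refl)

    ⊨literal⇔ : ∀ {n} (u : Term n) b {ρ} → A ⊨ literal u b [ ρ ] ⇔ truth ρ u ≡ b
    ⊨literal⇔ u true  = ⇔.trans (mk⇔ lower lift) (⇔.sym truth≡true⇔)
    ⊨literal⇔ u false = ⇔.trans (mk⇔ (_∘ lift) (_∘ lower)) (⇔.sym truth≡false⇔)

    ⊨typeFormula⇔ : ∀ {n} (L : List (Term n)) P {ρ} → A ⊨ typeFormula L P [ ρ ] ⇔ typeOf L ρ ≡ P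
    ⊨typeFormula⇔ []      []      = mk⇔ (λ _ → refl) (λ _ → λ ())
    ⊨typeFormula⇔ []      (_ ∷ _) = mk⇔ (λ ()) (λ ())
    ⊨typeFormula⇔ (_ ∷ _) []      = mk⇔ (λ ()) (λ ())
    ⊨typeFormula⇔ (u ∷ L) (b ∷ P) = ⇔.trans (⊨literal⇔ u b ×-⇔ ⊨typeFormula⇔ L P) ∷-≡⇔

    truth-≡⇒⇔ : ∀ {n} {ρ ρ′ : Vector Carrier n} {u} →
      truth ρ u ≡ truth ρ′ u → (⟦ u ⟧ ρ ≈ ⊤ ⇔ ⟦ u ⟧ ρ′ ≈ ⊤)
    truth-≡⇒⇔ same = ⇔.trans (⇔.sym truth≡true⇔)
      (⇔.trans (mk⇔ (≡.trans (≡.sym same)) (≡.trans same)) truth≡true⇔)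

    sameType⇒≈[] : ∀ {n N} (C : Cover n N) {ρ ρ′} →
      typeOf (Cover.members C) ρ ≡ typeOf (Cover.members C) ρ′ → ρ ≈[ N ] ρ′
    sameType⇒≈[] C {ρ} {ρ′} same φ φ-deg with Cover.complete C φ φ-deg
    ... | u , u∈ , φ≃u = ⇔.trans (≈⊤-resp (φ≃u ρ))
      (⇔.trans (truth-≡⇒⇔ (map-≡⇒≡ same u∈)) (≈⊤-resp (Eq.sym (φ≃u ρ′))))

    solves-addLiteral⇔ : ∀ {l} u b (S : System A l) {a q} →
      Solves A (addLiteral u b S) a q ⇔ (truth (q ∷ᵥ a) u ≡ b × Solves A S a q)
    solves-addLiteral⇔ u true (system t ss) = mk⇔
      (λ (u∧t≈⊤ , ss≉⊤) → let u≈⊤ , t≈⊤ = to ∧≈⊤⇔ u∧t≈⊤ in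
                           from truth≡true⇔ u≈⊤ , t≈⊤ , ss≉⊤)
      (λ (u-true , t≈⊤ , ss≉⊤) → from ∧≈⊤⇔ (to truth≡true⇔ u-true , t≈⊤) , ss≉⊤)
    solves-addLiteral⇔ u false (system t ss) = mk⇔
      (λ { (t≈⊤ , u≉⊤ ∷ ss≉⊤) → from truth≡false⇔ u≉⊤ , t≈⊤ , ss≉⊤ })
      (λ (u-false , t≈⊤ , ss≉⊤) → t≈⊤ , to truth≡false⇔ u-false ∷ ss≉⊤)

    solves-typeSystem⇔ : ∀ {l} (L : List (Term (suc l))) P {a q} →
      Solves A (typeSystem L P) a q ⇔ typeOf L (q ∷ᵥ a) ≡ P
    solves-typeSystem⇔ []      []      = mk⇔ (λ _ → refl) (λ _ → Eq.refl , [])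
    solves-typeSystem⇔ []      (_ ∷ _) = mk⇔ (⊥-elim ∘ unsolvable) (λ ())
    solves-typeSystem⇔ (_ ∷ _) []      = mk⇔ (⊥-elim ∘ unsolvable) (λ ())
    solves-typeSystem⇔ (u ∷ L) (b ∷ P) = ⇔.trans (solves-addLiteral⇔ u b (typeSystem L P))
      (⇔.trans (⇔.refl ×-⇔ solves-typeSystem⇔ L P) ∷-≡⇔)

    qeProperty⇒extension : QEProperty A → ExtensionProperty
    qeProperty⇒extension qe l N = M , extend
      where
      C = cover (suc l) N
      open Cover C
      M = proj₁ (qe l N)
      extend : ∀ {a a′} → a ≈[ M ] a′ → ∀ q → ∃[ q′ ] (q ∷ᵥ a) ≈[ N ] (q′ ∷ᵥ a′)
      extend {a} {a′} a≈a′ q =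
        let P = typeOf members (q ∷ᵥ a)
            S = typeSystem members P
            q′ , q′-solves = to (proj₂ (qe l N) a a′ a≈a′ S (typeSystem-deg members P members-deg))
                                (q , from (solves-typeSystem⇔ members P) refl)
        in q′ , sameType⇒≈[] C (≡.sym (to (solves-typeSystem⇔ members P) q′-solves))

    invariant⇒definable : ∀ {n N} {φ : Formula n} → Invariant N φ → Definable φ
    invariant⇒definable {n} {N} {φ} inv = ψ , ψ-qf , λ ρ → mk⇔ φ⇒ψ ψ⇒φ
      where
      C = cover n N
      open Cover C
      Realized : List Bool → Set (c ⊔ ℓ₁)
      Realized P = ∃[ ρ₀ ] typeOf members ρ₀ ≡ P × A ⊨ φ [ ρ₀ ]
      realized : List (List Bool)
      realized = filter {P = Realized} (λ _ → em) (labellings members)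
      ψ : Formula n
      ψ = ⋁ᶠ (map (typeFormula members) realized)
      ψ-qf : QuantifierFree ψ
      ψ-qf = ⋁ᶠ-qf (All.map⁺ {f = typeFormula members}
                             (All.tabulate {xs = realized} λ _ → typeFormula-qf members _))
      φ⇒ψ : ∀ {ρ} → A ⊨ φ [ ρ ] → A ⊨ ψ [ ρ ]
      φ⇒ψ {ρ} ρ⊨φ = ⋁ᶠ-intro {φs = map (typeFormula members) realized}
        (∈-map⁺ (typeFormula members) (∈-filter⁺ {P = Realized} (λ _ → em)
          (map∈labellings (truth ρ) members) (ρ , refl , ρ⊨φ)))
        (from (⊨typeFormula⇔ members _) refl)
      ψ⇒φ : ∀ {ρ} → A ⊨ ψ [ ρ ] → A ⊨ φ [ ρ ]
      ψ⇒φ ρ⊨ψ with ⋁ᶠ-elim {A = A} {φs = map (typeFormula members) realized} ρ⊨ψ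
      ... | _ , χ∈ , ρ⊨χ with ∈-map⁻ (typeFormula members) χ∈
      ... | P , P∈ , refl with ∈-filter⁻ {P = Realized} (λ _ → em) {xs = labellings members} P∈
      ... | _ , ρ₀ , ρ₀-type , ρ₀⊨φ =
        inv (sameType⇒≈[] C (≡.trans ρ₀-type (≡.sym (to (⊨typeFormula⇔ members P) ρ⊨χ)))) ρ₀⊨φ

    eliminates⇒extension : ThEliminatesQuantifiers A → ExtensionProperty
    eliminates⇒extension elim l N = M , extend
      where
      C = cover (suc l) N
      open Cover C
      realizable : List Bool → Formula l
      realizable P = ∃ᶠ (typeFormula members P)
      uniform : ∃[ M ] ∀ {P} → P ∈ labellings members → Invariant M (realizable P)
      uniform = uniformDegree realizable
        (λ P → definable⇒invariant {φ = realizable P} (elim l (realizable P))) (labellings members)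
      M = proj₁ uniform
      extend : ∀ {a a′} → a ≈[ M ] a′ → ∀ q → ∃[ q′ ] (q ∷ᵥ a) ≈[ N ] (q′ ∷ᵥ a′)
      extend {a} a≈a′ q =
        let q′ , q′-type = proj₂ uniform (map∈labellings (truth (q ∷ᵥ a)) members) a≈a′
                             (q , from (⊨typeFormula⇔ members _) refl)
        in q′ , sameType⇒≈[] C (≡.sym (to (⊨typeFormula⇔ members _) q′-type))

    qeProperty⇔extension : QEProperty A ⇔ ExtensionProperty
    qeProperty⇔extension = mk⇔ qeProperty⇒extension extension⇒qeProperty

    extension⇔eliminates : ExtensionProperty ⇔ ThEliminatesQuantifiers A
    extension⇔eliminates = mk⇔
      (λ ext n φ → invariant⇒definable (proj₂ (extension⇒invariant ext φ)))
      eliminates⇒extension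

proposition4p4 : ∀ {c ℓ₁ ℓ₂ : Level} → ExcludedMiddle (c ⊔ ℓ₁) →
    (A : HeytingAlgebra c ℓ₁ ℓ₂) → QEProperty A ⇔ ThEliminatesQuantifiers A
proposition4p4 em A = ⇔.trans (qeProperty⇔extension A em) (extension⇔eliminates A em)
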